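{- For any two full binary trees $T_1$ and $T_2$, each with $n$ internal nodes, of rank $r_1$ and $r_2$ respectively, we have $d_R(T_1,T_2)\le n^2\bigl(1+(2n+1)(r_1+r_2-2)\bigr)$.
   Context: A full binary tree is a rooted ordered tree in which every node is either a leaf or an internal node with exactly two children. A right rotation at an internal node $a$ whose left child $b$ is internal, where $C,D$ are the left and right subtrees of $b$ and $E$ is the right subtree of $a$, replaces the subtree rooted at $a$ by the tree with root $b$, left subtree $C$, and right child $a$ whose left and right subtrees are $D$ and $E$; a left rotation is the symmetric (inverse) operation. The rank of a node is defined inductively: a leaf has rank $0$; an internal node with children $v,w$ has rank $\mathrm{rank}(v)+1$ if $\mathrm{rank}(v)=\mathrm{rank}(w)$, and $\max\{\mathrm{rank}(v),\mathrm{rank}(w)\}$ otherwise; the rank of a tree is the rank of its root. For $T_1,T_2$ with the same number of internal nodes, let $r=\max\{\mathrm{rank}(T_1),\mathrm{rank}(T_2)\}$; $d_R(T_1,T_2)$ is the minimum length of a sequence of rotations transforming $T_1$ into $T_2$ such that every intermediate tree has rank at most $r$. -}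

module Defs where

open import Data.Nat using (ℕ; zero; suc; _+_; _⊔_; _≤_)
open import Relation.Nullary using (Dec; yes; no)
open import Data.Nat using (_≟_)
open import Data.Product using (∃; _×_)

data Tree : Set where
  leaf : Tree
  node : Tree → Tree → Tree

internal : Tree → ℕ
internal leaf = 0
internal (node l r) = suc (internal l + internal r)

rankAux : ℕ → ℕ → ℕ
rankAux a b with a ≟ b
... | yes _ = suc a
... | no  _ = a ⊔ b

rank : Tree → ℕ
rank leaf = 0
rank (node l r) = rankAux (rank l) (rank r)

data Rot : Tree → Tree → Set where
  rotR  : ∀ C D E → Rot (node (node C D) E) (node C (node D E))
  rotL  : ∀ C D E → Rot (node C (node D E)) (node (node C D) E)
  inL   : ∀ {l l'} r → Rot l l' → Rot (node l r) (node l' r)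
  inR   : ∀ l {r r'} → Rot r r' → Rot (node l r) (node l r')

data RotPath (r : ℕ) : ℕ → Tree → Tree → Set where
  done : ∀ {T} → rank T ≤ r → RotPath r 0 T T
  step : ∀ {k T U V} → rank T ≤ r → Rot T U → RotPath r k U V → RotPath r (suc k) T V

-- d_R(T1,T2) ≤ m : there is a rank-bounded rotation sequence of length at most m,
-- with bound r = max(rank T1, rank T2).
dR≤ : Tree → Tree → ℕ → Set
dR≤ T₁ T₂ m = ∃ λ k → (k ≤ m) × RotPath (rank T₁ ⊔ rank T₂) k T₁ T₂

module Submission where

-- Every tree T with n internal nodes can be rotated into the right comb with n internal
-- nodes: recursively combify both subtrees, then p right rotations at the root merge
-- node (comb p) (comb q) into comb (p + q + 1).  Rotations inside a subtree never raise
-- the rank beyond that of T (rank is monotone in the children), and combs have rank ≤ 1,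
-- so the whole path stays within rank T.  The number of rotations satisfies
-- steps (node A B) = steps A + steps B + internal A, whence 2 · steps T ≤ n².  Going T₁ → comb → T₂ gives at most
-- n² ≤ the claimed bound.

open import Defs
open import Data.Nat using (ℕ; _+_; _*_; _∸_)
open import Relation.Binary.PropositionalEquality using (_≡_)

open import Data.Nat using (zero; suc; _≤_; _⊔_; z≤n; s≤s; _≟_)
open import Data.Nat.Properties
open import Data.Nat.Solver using (module +-*-Solver)
open import Data.Product using (_,_)
open import Data.Sum using (inj₁; inj₂)
open import Data.Empty using (⊥-elim)
open import Function using (id)
open import Relation.Nullary using (yes; no)
open import Relation.Binary.PropositionalEquality using (refl; sym; subst)

rankAux-comm : ∀ a b → rankAux a b ≡ rankAux b a
rankAux-comm a b with a ≟ b | b ≟ a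
... | yes refl | yes _  = refl
... | yes refl | no a≢a = ⊥-elim (a≢a refl)
... | no b≢b   | yes refl = ⊥-elim (b≢b refl)
... | no _     | no _   = ⊔-comm a b

rankAux-monoˡ : ∀ {a a′} b → a ≤ a′ → rankAux a b ≤ rankAux a′ b
rankAux-monoˡ {a} {a′} b a≤a′ with a ≟ b | a′ ≟ b
... | yes refl | yes refl = ≤-refl
... | yes refl | no a′≢a  = ≤-trans (≤∧≢⇒< a≤a′ (λ a≡a′ → a′≢a (sym a≡a′))) (m≤m⊔n a′ a)
... | no _     | yes refl = ≤-trans (⊔-lub a≤a′ ≤-refl) (n≤1+n a′)
... | no _     | no _     = ⊔-monoˡ-≤ b a≤a′

rankAux-mono : ∀ {a a′ b b′} → a ≤ a′ → b ≤ b′ → rankAux a b ≤ rankAux a′ b′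
rankAux-mono {a} {a′} {b} {b′} a≤a′ b≤b′ = begin
  rankAux a b    ≤⟨ rankAux-monoˡ b a≤a′ ⟩
  rankAux a′ b   ≡⟨ rankAux-comm a′ b ⟩
  rankAux b a′   ≤⟨ rankAux-monoˡ a′ b≤b′ ⟩
  rankAux b′ a′  ≡⟨ rankAux-comm b′ a′ ⟩
  rankAux a′ b′  ∎
  where open ≤-Reasoning

rankAux-positive : ∀ a b → 1 ≤ rankAux a b
rankAux-positive a b with a ≟ b
... | yes _ = s≤s z≤n
rankAux-positive zero    zero    | no 0≢0 = ⊥-elim (0≢0 refl)
rankAux-positive zero    (suc b) | no _   = s≤s z≤n
rankAux-positive (suc a) b       | no _   = ≤-trans (s≤s z≤n) (m≤m⊔n (suc a) b)

rankAux-zeroˡ-≤ : ∀ {b R} → 1 ≤ R → b ≤ R → rankAux 0 b ≤ R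
rankAux-zeroˡ-≤ {b} 1≤R b≤R with 0 ≟ b
... | yes _ = 1≤R
... | no _  = b≤R

rank-node-positive : ∀ A B → 1 ≤ rank (node A B)
rank-node-positive A B = rankAux-positive (rank A) (rank B)

Rot-sym : ∀ {T U} → Rot T U → Rot U T
Rot-sym (rotR C D E) = rotL C D E
Rot-sym (rotL C D E) = rotR C D E
Rot-sym (inL r ρ)    = inL r (Rot-sym ρ)
Rot-sym (inR l ρ)    = inR l (Rot-sym ρ)

RotPath-rankˡ : ∀ {r k T U} → RotPath r k T U → rank T ≤ r
RotPath-rankˡ (done T≤r)     = T≤r
RotPath-rankˡ (step T≤r _ _) = T≤r

RotPath-trans : ∀ {r k m T U V} → RotPath r k T U → RotPath r m U V → RotPath r (k + m) T V
RotPath-trans (done _)       Q = Q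
RotPath-trans (step T≤r ρ P) Q = step T≤r ρ (RotPath-trans P Q)

RotPath-sym : ∀ {r k T U} → RotPath r k T U → RotPath r k U T
RotPath-sym (done T≤r) = done T≤r
RotPath-sym {r} {suc k} {T} {U} (step T≤r ρ P) =
  subst (λ m → RotPath r m U T) (+-comm k 1)
        (RotPath-trans (RotPath-sym P) (step (RotPath-rankˡ P) (Rot-sym ρ) (done T≤r)))

RotPath-map : ∀ {r r′ k T U} (F : Tree → Tree) →
              (∀ {X Y} → Rot X Y → Rot (F X) (F Y)) →
              (∀ {X} → rank X ≤ r → rank (F X) ≤ r′) →
              RotPath r k T U → RotPath r′ k (F T) (F U)
RotPath-map F Rot-F rank-F (done T≤r)     = done (rank-F T≤r)
RotPath-map F Rot-F rank-F (step T≤r ρ P) = step (rank-F T≤r) (Rot-F ρ) (RotPath-map F Rot-F rank-F P)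

RotPath-weaken : ∀ {r r′ k T U} → r ≤ r′ → RotPath r k T U → RotPath r′ k T U
RotPath-weaken r≤r′ = RotPath-map id id (λ X≤r → ≤-trans X≤r r≤r′)

comb : ℕ → Tree
comb zero    = leaf
comb (suc k) = node leaf (comb k)

rank-comb-suc : ∀ k → rank (comb (suc k)) ≡ 1
rank-comb-suc zero = refl
rank-comb-suc (suc k) rewrite rank-comb-suc k = refl

rank-comb-≤1 : ∀ k → rank (comb k) ≤ 1
rank-comb-≤1 zero    = z≤n
rank-comb-≤1 (suc k) = ≤-reflexive (rank-comb-suc k)

rank-comb-≤ : ∀ T → rank (comb (internal T)) ≤ rank T
rank-comb-≤ leaf       = z≤n
rank-comb-≤ (node A B) = ≤-trans (rank-comb-≤1 (internal (node A B))) (rank-node-positive A B)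

merge-combs : ∀ {R} p q → 1 ≤ R → rank (node (comb p) (comb q)) ≤ R →
              RotPath R p (node (comb p) (comb q)) (comb (suc (p + q)))
merge-combs zero    q 1≤R root≤R = done root≤R
merge-combs (suc p) q 1≤R root≤R =
  step root≤R (rotR leaf (comb p) (comb q))
       (RotPath-map (node leaf) (inR leaf) (rankAux-zeroˡ-≤ 1≤R)
                    (merge-combs p q 1≤R (≤-trans inner≤root root≤R)))
  where
  inner≤root : rank (node (comb p) (comb q)) ≤ rank (node (comb (suc p)) (comb q))
  inner≤root = rankAux-monoˡ (rank (comb q))
                 (≤-trans (rank-comb-≤1 p) (≤-reflexive (sym (rank-comb-suc p))))

steps : Tree → ℕ
steps leaf       = 0
steps (node A B) = steps A + (steps B + internal A)

toComb : ∀ T → RotPath (rank T) (steps T) T (comb (internal T))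
toComb leaf = done z≤n
toComb (node A B) =
  RotPath-trans (RotPath-map (λ X → node X B) (inL B) (rankAux-monoˡ (rank B)) (toComb A))
  (RotPath-trans (RotPath-map (node (comb a)) (inR (comb a)) (rankAux-mono (rank-comb-≤ A)) (toComb B))
                 (merge-combs a (internal B) (rank-node-positive A B)
                              (rankAux-mono (rank-comb-≤ A) (rank-comb-≤ B))))
  where a = internal A

steps-double-≤ : ∀ T → steps T + steps T ≤ internal T * internal T
steps-double-≤ leaf       = z≤n
steps-double-≤ (node A B) = begin
    (sA + (sB + a)) + (sA + (sB + a))
      ≡⟨ solve 3 (λ x y z → (x :+ (y :+ z)) :+ (x :+ (y :+ z)) := (x :+ x) :+ (y :+ y) :+ (z :+ z))
               refl sA sB a ⟩
    (sA + sA) + (sB + sB) + (a + a)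
      ≤⟨ +-monoˡ-≤ (a + a) (+-mono-≤ (steps-double-≤ A) (steps-double-≤ B)) ⟩
    a * a + b * b + (a + a)
      ≤⟨ m≤m+n _ (suc (a * b + a * b + b + b)) ⟩
    a * a + b * b + (a + a) + suc (a * b + a * b + b + b)
      ≡⟨ solve 2 (λ x y → x :* x :+ y :* y :+ (x :+ x) :+ (con 1 :+ (x :* y :+ x :* y :+ y :+ y))
                          := (con 1 :+ (x :+ y)) :* (con 1 :+ (x :+ y)))
               refl a b ⟩
    suc (a + b) * suc (a + b) ∎
  where
  open ≤-Reasoning
  open +-*-Solver
  sA = steps A
  sB = steps B
  a  = internal A
  b  = internal B

+-≤-from-doubles : ∀ x y {m} → x + x ≤ m → y + y ≤ m → x + y ≤ m
+-≤-from-doubles x y 2x≤m 2y≤m with ≤-total x y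
... | inj₁ x≤y = ≤-trans (+-monoˡ-≤ y x≤y) 2y≤m
... | inj₂ y≤x = ≤-trans (+-monoʳ-≤ x y≤x) 2x≤m

rotPath-via-comb : ∀ T₁ T₂ → internal T₁ ≡ internal T₂ →
                   RotPath (rank T₁ ⊔ rank T₂) (steps T₁ + steps T₂) T₁ T₂
rotPath-via-comb T₁ T₂ n₁≡n₂ =
  RotPath-trans (RotPath-weaken (m≤m⊔n (rank T₁) (rank T₂)) (toComb T₁))
                (subst (λ n → RotPath (rank T₁ ⊔ rank T₂) (steps T₂) (comb n) T₂) (sym n₁≡n₂)
                       (RotPath-sym (RotPath-weaken (m≤n⊔m (rank T₁) (rank T₂)) (toComb T₂))))

theorem3 : ∀ (n : ℕ) (T₁ T₂ : Tree) → internal T₁ ≡ n → internal T₂ ≡ n →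
           dR≤ T₁ T₂ (n * n * (1 + (2 * n + 1) * (rank T₁ + rank T₂ ∸ 2)))
theorem3 n T₁ T₂ refl n₂≡n =
  steps T₁ + steps T₂ ,
  ≤-trans (+-≤-from-doubles (steps T₁) (steps T₂)
                            (steps-double-≤ T₁)
                            (subst (λ m → steps T₂ + steps T₂ ≤ m * m) n₂≡n (steps-double-≤ T₂)))
          (m≤m*n (n * n) _) ,
  rotPath-via-comb T₁ T₂ (sym n₂≡n)
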